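{- Let $p$ be an odd prime and $\chi=\left(\frac{\cdot}{p}\right)$ the Legendre symbol. Let $A,B,C\in\mathbb{Z}$ with $\gcd(A,p)=1$ and $B^2-4AC\equiv 0\pmod p$. Then $$\sum_{\substack{b,x,y\in(\mathbb{Z}/p\mathbb{Z})^\times\\ x,y\not\equiv 1\ (p)\\ b\equiv -B(2A)^{ -1}\ (p)}}\chi\big(y(1-x)(A(1-y)^{ -1}(y-x)b^2-Bb-Cx^{ -1})\big)=\sum_{\substack{b,x,y\in(\mathbb{Z}/p\mathbb{Z})^\times\\ x,y\not\equiv 1\ (p)\\ Ab^2+Bb+C\equiv 0\ (p)}}\chi\big(y(A(1-y)^{ -1}b^2-Cx^{ -1})\big)=\chi(C)+\chi(-C).$$
   Context: $\chi(a)=0$ when $p\mid a$. Inverses $x^{ -1}$, $(1-y)^{ -1}$, $(2A)^{ -1}$ are taken in $\mathbb{Z}/p\mathbb{Z}$. -}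

module Defs where

open import Data.Nat as ℕ using (ℕ; zero; suc; NonZero)
open import Data.Nat.DivMod as ℕD using ()
open import Data.Integer as ℤ using (ℤ; +_; 0ℤ; 1ℤ; -1ℤ)
open import Data.Integer.DivMod using (_%ℕ_)
open import Data.Fin using (Fin; toℕ)
open import Data.Fin.Properties using (any?)
open import Data.List using (List; map; upTo; foldr)
open import Data.Product using (∃; _,_)
open import Relation.Nullary using (Dec; yes; no)
open import Relation.Binary.PropositionalEquality using (_≡_)

res : (p : ℕ) .{{_ : NonZero p}} → ℤ → ℕ
res p a = a %ℕ p

_≡[_]_ : ℤ → (p : ℕ) .{{_ : NonZero p}} → ℤ → Set
a ≡[ p ] b = res p a ≡ res p b

_≡[_]?_ : (a : ℤ) (p : ℕ) .{{_ : NonZero p}} (b : ℤ) → Dec (a ≡[ p ] b)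
a ≡[ p ]? b = res p a ℕ.≟ res p b

IsSquareMod : (p : ℕ) .{{_ : NonZero p}} → ℤ → Set
IsSquareMod p a = ∃ λ (x : Fin p) → (toℕ x ℕ.* toℕ x) ℕ.% p ≡ res p a

isSquareMod? : (p : ℕ) .{{_ : NonZero p}} (a : ℤ) → Dec (IsSquareMod p a)
isSquareMod? p a = any? λ x → (toℕ x ℕ.* toℕ x) ℕ.% p ℕ.≟ res p a

legendre : (p : ℕ) .{{_ : NonZero p}} → ℤ → ℤ
legendre p a with res p a ℕ.≟ 0
... | yes _ = 0ℤ
... | no _ with isSquareMod? p a
...   | yes _ = 1ℤ
...   | no _ = -1ℤ

-- inverse in Z/pZ: the x ∈ {0,…,p-1} with x·a ≡ 1 (mod p) (0 if none exists)
invMod : (p : ℕ) .{{_ : NonZero p}} → ℤ → ℤ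
invMod p a with any? (λ (x : Fin p) → (toℕ x ℕ.* res p a) ℕ.% p ℕ.≟ 1 ℕ.% p)
... | yes (x , _) = + toℕ x
... | no _ = 0ℤ

units : ℕ → List ℤ
units p = map (λ k → + suc k) (upTo (p ℕ.∸ 1))

Σu : ℕ → (ℤ → ℤ) → ℤ
Σu p f = foldr ℤ._+_ 0ℤ (map f (units p))

S₁ : (p : ℕ) .{{_ : NonZero p}} → ℤ → ℤ → ℤ → ℤ
S₁ p A B C = Σu p λ b → Σu p λ x → Σu p λ y → term b x y
  where
  term : ℤ → ℤ → ℤ → ℤ
  term b x y with x ≡[ p ]? 1ℤ | y ≡[ p ]? 1ℤ | b ≡[ p ]? (ℤ.- B ℤ.* invMod p (+ 2 ℤ.* A))
  ... | no _ | no _ | yes _ =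
        legendre p (y ℤ.* (1ℤ ℤ.- x) ℤ.*
          (A ℤ.* invMod p (1ℤ ℤ.- y) ℤ.* (y ℤ.- x) ℤ.* (b ℤ.* b) ℤ.- B ℤ.* b ℤ.- C ℤ.* invMod p x))
  ... | _ | _ | _ = 0ℤ

S₂ : (p : ℕ) .{{_ : NonZero p}} → ℤ → ℤ → ℤ → ℤ
S₂ p A B C = Σu p λ b → Σu p λ x → Σu p λ y → term b x y
  where
  term : ℤ → ℤ → ℤ → ℤ
  term b x y with x ≡[ p ]? 1ℤ | y ≡[ p ]? 1ℤ | (A ℤ.* (b ℤ.* b) ℤ.+ B ℤ.* b ℤ.+ C) ≡[ p ]? 0ℤ
  ... | no _ | no _ | yes _ =
        legendre p (y ℤ.* (A ℤ.* invMod p (1ℤ ℤ.- y) ℤ.* (b ℤ.* b) ℤ.- C ℤ.* invMod p x))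
  ... | _ | _ | _ = 0ℤ

{-# OPTIONS --safe #-}
-- Since p ∤ A and p ∣ B² − 4AC, 4A(Ab² + Bb + C) ≡ (2Ab + B)² shows that
-- Ab² + Bb + C ≡ 0 exactly when b ≡ b₀ = −B(2A)⁻¹, and then Ab₀² ≡ C.  On that
-- support the argument of χ in S₁ is (1 − x)² times the one in S₂, so S₁ = S₂.
-- If p ∣ C no unit b is a root and S₂ = 0.  Otherwise
-- S₂ = Σ_{x,y ≠ 0,1} χ(yC((1 − y)⁻¹ − x⁻¹)).  With the convention 0⁻¹ = 0,
-- inversion permutes ℤ/p, so a complete sum Σ_z χ(k z⁻¹ + c) with p ∤ k vanishes
-- (as Σ_z χ(z) = 0, counting solutions of s² = w in two ways).  Completing the
-- x-sum leaves −χ(C(y⁻¹ − 1)) − χ(C(1 − y)⁻¹) after removing squares, and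
-- completing the y-sums in the same way leaves the y = 0 terms χ(−C) + χ(C)
-- (those at y = 1 vanish).
module Submission where

open import Defs
open import Data.Nat as ℕ using (ℕ; zero; suc; NonZero)
import Data.Nat.Properties as ℕ
import Data.Nat.Divisibility as ℕ
import Data.Nat.DivMod as ℕ
import Data.Nat.GCD as ℕ
open import Data.Nat.Primality using (Prime; euclidsLemma; prime⇒nonTrivial)
open import Data.Nat.Coprimality using (prime⇒coprime; coprime-Bézout)
open import Data.Integer as ℤ using (ℤ; +_; 0ℤ; 1ℤ; -1ℤ; _+_; _-_; _*_; -_; ∣_∣)
import Data.Integer.Properties as ℤ
open import Data.Integer.DivMod using (a≡a%ℕn+[a/ℕn]*n; n%ℕd<d; _/ℕ_)
open import Data.Integer.Divisibility.Signed as Signed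
  using (divides; ∣m∣n⇒∣m+n; ∣m+n∣n⇒∣m; ∣n⇒∣m*n; ∣m⇒∣m*n; ∣m⇒∣-m; ∣⇒∣ᵤ; ∣ᵤ⇒∣)
open import Data.Integer.GCD using (gcd)
open import Data.Integer.Tactic.RingSolver using (solve-∀)
open import Data.Fin as Fin using (Fin; toℕ; fromℕ<)
import Data.Fin.Properties as Fin
open import Data.Fin.Permutation using (Permutation; permutation)
open import Data.List using (foldr; upTo; applyUpTo)
import Data.List.Properties as List
open import Algebra.Properties.Semiring.Sum ℤ.+-*-semiring
  using (sum-syntax; sum-cong-≗; sum-replicate-zero; ∑-comm; ∑-permute; ∑-distrib-+; *-distribˡ-sum)
open import Algebra.Properties.AbelianGroup ℤ.+-0-abelianGroup using (∙-cancelˡ)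
open import Data.Empty using (⊥-elim)
open import Function using (_∘_)
open import Data.Product using (∃; _×_; _,_; proj₁; proj₂)
open import Data.Sum using (_⊎_; inj₁; inj₂)
open import Relation.Nullary using (Dec; yes; no; ¬_)
open import Relation.Nullary.Decidable using (map′; ¬?)
open import Relation.Binary using (IsEquivalence; Setoid)
import Relation.Binary.Reasoning.Setoid as ≈-Reasoning
open import Relation.Binary.PropositionalEquality

𝟙 : ∀ {P : Set} → Dec P → ℤ
𝟙 (yes _) = 1ℤ
𝟙 (no _)  = 0ℤ

𝟙-yes : ∀ {P : Set} (d : Dec P) → P → 𝟙 d ≡ 1ℤ
𝟙-yes (yes _) _ = refl
𝟙-yes (no ¬P) P = ⊥-elim (¬P P)

𝟙-no : ∀ {P : Set} (d : Dec P) → ¬ P → 𝟙 d ≡ 0ℤ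
𝟙-no (yes P) ¬P = ⊥-elim (¬P P)
𝟙-no (no _)  _  = refl

𝟙-cong : ∀ {P Q : Set} (d : Dec P) (e : Dec Q) → (P → Q) → (Q → P) → 𝟙 d ≡ 𝟙 e
𝟙-cong d (yes Q) _   Q⇒P = 𝟙-yes d (Q⇒P Q)
𝟙-cong d (no ¬Q) P⇒Q _   = 𝟙-no d (¬Q ∘ P⇒Q)

𝟙-*-cong : ∀ {P : Set} (d : Dec P) {a b} → (P → a ≡ b) → 𝟙 d * a ≡ 𝟙 d * b
𝟙-*-cong (yes P) P⇒a≡b = cong (1ℤ *_) (P⇒a≡b P)
𝟙-*-cong (no _)  _     = refl

𝟙-¬?-split : ∀ {P : Set} (d : Dec P) a → a ≡ 𝟙 (¬? d) * a + 𝟙 d * a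
𝟙-¬?-split (yes _) a = sym (trans (ℤ.+-identityˡ (1ℤ * a)) (ℤ.*-identityˡ a))
𝟙-¬?-split (no _)  a = sym (trans (ℤ.+-identityʳ (1ℤ * a)) (ℤ.*-identityˡ a))

private
  foldr-applyUpTo : ∀ n (g : ℕ → ℤ) → foldr _+_ 0ℤ (applyUpTo g n) ≡ ∑[ i < n ] g (toℕ i)
  foldr-applyUpTo zero    g = refl
  foldr-applyUpTo (suc n) g = cong (_+_ (g 0)) (foldr-applyUpTo n (g ∘ suc))

Σu≡sum : ∀ q f → Σu q f ≡ ∑[ i < q ℕ.∸ 1 ] f (+ suc (toℕ i))
Σu≡sum q f = trans (cong (foldr _+_ 0ℤ) (trans (sym (List.map-∘ (upTo (q ℕ.∸ 1)))) (List.map-upTo (f ∘ +_ ∘ suc) (q ℕ.∸ 1))))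
                   (foldr-applyUpTo (q ℕ.∸ 1) (f ∘ +_ ∘ suc))

Σu-0 : ∀ q → Σu q (λ _ → 0ℤ) ≡ 0ℤ
Σu-0 q = trans (Σu≡sum q (λ _ → 0ℤ)) (sum-replicate-zero (q ℕ.∸ 1))

*-distribˡ-Σu : ∀ q c f → c * Σu q f ≡ Σu q (λ z → c * f z)
*-distribˡ-Σu q c f = trans (cong (c *_) (Σu≡sum q f))
  (trans (*-distribˡ-sum {q ℕ.∸ 1} c (λ i → f (+ suc (toℕ i)))) (sym (Σu≡sum q (λ z → c * f z))))

-‿distrib-Σu : ∀ q f → - Σu q f ≡ Σu q (λ z → - f z)
-‿distrib-Σu q f = trans (sym (ℤ.-1*i≡-i (Σu q f)))
  (trans (*-distribˡ-Σu q -1ℤ f) (cong (foldr _+_ 0ℤ) (List.map-cong (ℤ.-1*i≡-i ∘ f) (units q))))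

Σu-comm : ∀ q (f : ℤ → ℤ → ℤ) → Σu q (λ x → Σu q (f x)) ≡ Σu q (λ y → Σu q (λ x → f x y))
Σu-comm q f = begin
  Σu q (λ x → Σu q (f x))                                   ≡⟨ Σu≡sum q _ ⟩
  ∑[ i < n ] Σu q (f (ι i))                                 ≡⟨ sum-cong-≗ {n} (λ i → Σu≡sum q _) ⟩
  ∑[ i < n ] ∑[ j < n ] f (ι i) (ι j)                       ≡⟨ ∑-comm {n} {n} _ ⟩
  ∑[ j < n ] ∑[ i < n ] f (ι i) (ι j)                       ≡⟨ sum-cong-≗ {n} (λ j → Σu≡sum q _) ⟨
  ∑[ j < n ] Σu q (λ x → f x (ι j))                         ≡⟨ Σu≡sum q _ ⟨
  Σu q (λ y → Σu q (λ x → f x y))                           ∎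
  where
  open ≡-Reasoning
  n : ℕ
  n = q ℕ.∸ 1
  ι : Fin n → ℤ
  ι i = + suc (toℕ i)

sum-residues : ∀ q .{{_ : NonZero q}} f → ∑[ i < q ] f (+ toℕ i) ≡ f 0ℤ + Σu q f
sum-residues (suc m) f = cong (_+_ (f 0ℤ)) (sym (Σu≡sum (suc m) f))

-- Congruences are proved like a linear combination: a ring identity over ℤ,
-- checked by the solver, writes the difference of the two sides as an integer
-- combination of known multiples of p.
module Congruence (p : ℕ) .{{_ : NonZero p}} where

  open Signed using (_∣_)

  infix 4 _≈_

  record _≈_ (a b : ℤ) : Set where
    constructor mk≈
    field ∣-difference : + p ∣ a - b
  open _≈_ public

  ≈-by : ∀ {a b c} → a - b ≡ c → + p ∣ c → a ≈ b
  ≈-by eq p∣c = mk≈ (subst (+ p ∣_) (sym eq) p∣c)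

  ∣-resp-≡ : ∀ {a b} → a ≡ b → + p ∣ a → + p ∣ b
  ∣-resp-≡ = subst (+ p ∣_)

  p∣0 : + p ∣ 0ℤ
  p∣0 = divides 0ℤ refl

  ≈-reflexive : ∀ {a b} → a ≡ b → a ≈ b
  ≈-reflexive {a} refl = ≈-by (ℤ.+-inverseʳ a) p∣0

  ≈-refl : ∀ {a} → a ≈ a
  ≈-refl = ≈-reflexive refl

  ≈-sym : ∀ {a b} → a ≈ b → b ≈ a
  ≈-sym {a} {b} (mk≈ d) = ≈-by (identity a b) (∣m⇒∣-m d)
    where
    identity : ∀ a b → b - a ≡ - (a - b)
    identity = solve-∀

  ≈-trans : ∀ {a b c} → a ≈ b → b ≈ c → a ≈ c
  ≈-trans {a} {b} {c} (mk≈ d) (mk≈ e) = ≈-by (identity a b c) (∣m∣n⇒∣m+n d e)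
    where
    identity : ∀ a b c → a - c ≡ (a - b) + (b - c)
    identity = solve-∀

  ≈-isEquivalence : IsEquivalence _≈_
  ≈-isEquivalence = record { refl = ≈-refl ; sym = ≈-sym ; trans = ≈-trans }

  ≈-setoid : Setoid _ _
  ≈-setoid = record { isEquivalence = ≈-isEquivalence }

  +-cong : ∀ {a a′ b b′} → a ≈ a′ → b ≈ b′ → a + b ≈ a′ + b′
  +-cong {a} {a′} {b} {b′} (mk≈ d) (mk≈ e) = ≈-by (identity a a′ b b′) (∣m∣n⇒∣m+n d e)
    where
    identity : ∀ a a′ b b′ → (a + b) - (a′ + b′) ≡ (a - a′) + (b - b′)
    identity = solve-∀

  *-cong : ∀ {a a′ b b′} → a ≈ a′ → b ≈ b′ → a * b ≈ a′ * b′
  *-cong {a} {a′} {b} {b′} (mk≈ d) (mk≈ e) =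
    ≈-by (identity a a′ b b′) (∣m∣n⇒∣m+n (∣n⇒∣m*n b d) (∣n⇒∣m*n a′ e))
    where
    identity : ∀ a a′ b b′ → a * b - a′ * b′ ≡ b * (a - a′) + a′ * (b - b′)
    identity = solve-∀

  -‿cong : ∀ {a a′} → a ≈ a′ → - a ≈ - a′
  -‿cong {a} {a′} (mk≈ d) = ≈-by (identity a a′) (∣m⇒∣-m d)
    where
    identity : ∀ a a′ → - a - - a′ ≡ - (a - a′)
    identity = solve-∀

  *-congˡ : ∀ c {a b} → a ≈ b → c * a ≈ c * b
  *-congˡ c = *-cong (≈-refl {c})

  +-congʳ : ∀ c {a b} → a ≈ b → a + c ≈ b + c
  +-congʳ c e = +-cong e (≈-refl {c})

  ∣⇒≈0 : ∀ {a} → + p ∣ a → a ≈ 0ℤ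
  ∣⇒≈0 {a} = ≈-by (ℤ.+-identityʳ a)

  ≈0⇒∣ : ∀ {a} → a ≈ 0ℤ → + p ∣ a
  ≈0⇒∣ {a} (mk≈ d) = ∣-resp-≡ (ℤ.+-identityʳ a) d

  ∣-resp-≈ : ∀ {a b} → a ≈ b → + p ∣ a → + p ∣ b
  ∣-resp-≈ a≈b p∣a = ≈0⇒∣ (≈-trans (≈-sym a≈b) (∣⇒≈0 p∣a))

  ≈-residue : ∀ a → a ≈ + res p a
  ≈-residue a = ≈-by (trans (cong (_- + res p a) (a≡a%ℕn+[a/ℕn]*n a p)) (identity (+ res p a) (a /ℕ p) (+ p)))
                     (divides (a /ℕ p) refl)
    where
    identity : ∀ r q p → r + q * p - r ≡ q * p
    identity = solve-∀

  p∣n<p⇒n≡0 : ∀ {n} → n ℕ.< p → p ℕ.∣ n → n ≡ 0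
  p∣n<p⇒n≡0 {zero}  _   _   = refl
  p∣n<p⇒n≡0 {suc n} n<p p∣n = ⊥-elim (ℕ.>⇒∤ n<p p∣n)

  ≈∧≤-below-p⇒≡ : ∀ {r s} → s ℕ.< p → r ℕ.≤ s → + r ≈ + s → r ≡ s
  ≈∧≤-below-p⇒≡ {r} {s} s<p r≤s (mk≈ d) = ℕ.≤-antisym r≤s (ℕ.m∸n≡0⇒m≤n
    (p∣n<p⇒n≡0 (ℕ.≤-<-trans (ℕ.m∸n≤m s r) s<p)
      (subst (p ℕ.∣_) (trans (cong ∣_∣ (ℤ.m-n≡m⊖n r s)) (ℤ.∣⊖∣-≤ r≤s)) (∣⇒∣ᵤ d))))

  ≈-below-p⇒≡ : ∀ {r s} → r ℕ.< p → s ℕ.< p → + r ≈ + s → r ≡ s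
  ≈-below-p⇒≡ {r} {s} r<p s<p r≈s with ℕ.≤-total r s
  ... | inj₁ r≤s = ≈∧≤-below-p⇒≡ s<p r≤s r≈s
  ... | inj₂ s≤r = sym (≈∧≤-below-p⇒≡ r<p s≤r (≈-sym r≈s))

  ≈⇒≡[p] : ∀ {a b} → a ≈ b → a ≡[ p ] b
  ≈⇒≡[p] {a} {b} a≈b = ≈-below-p⇒≡ (n%ℕd<d a p) (n%ℕd<d b p)
    (≈-trans (≈-sym (≈-residue a)) (≈-trans a≈b (≈-residue b)))

  ≡[p]⇒≈ : ∀ {a b} → a ≡[ p ] b → a ≈ b
  ≡[p]⇒≈ {a} {b} eq = ≈-trans (≈-residue a) (≈-trans (≈-reflexive (cong +_ eq)) (≈-sym (≈-residue b)))

  Respects≈ : (ℤ → ℤ) → Set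
  Respects≈ f = ∀ {a b} → a ≈ b → f a ≡ f b

  -- Built from the decision used in Defs, so that they reduce along with the
  -- summands of S₁ and S₂.
  δ : ℤ → ℤ → ℤ
  δ c z = 𝟙 (z ≡[ p ]? c)

  δ≉ : ℤ → ℤ → ℤ
  δ≉ c z = 𝟙 (¬? (z ≡[ p ]? c))

  δ-≈ : ∀ {c z} → z ≈ c → δ c z ≡ 1ℤ
  δ-≈ {c} {z} z≈c = 𝟙-yes (z ≡[ p ]? c) (≈⇒≡[p] z≈c)

  δ-≉ : ∀ {c z} → ¬ (z ≈ c) → δ c z ≡ 0ℤ
  δ-≉ {c} {z} z≉c = 𝟙-no (z ≡[ p ]? c) (z≉c ∘ ≡[p]⇒≈)

  δ-cong : ∀ {c z c′ z′} → (z ≈ c → z′ ≈ c′) → (z′ ≈ c′ → z ≈ c) → δ c z ≡ δ c′ z′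
  δ-cong {c} {z} {c′} {z′} ⇒ ⇐ =
    𝟙-cong (z ≡[ p ]? c) (z′ ≡[ p ]? c′) (≈⇒≡[p] ∘ ⇒ ∘ ≡[p]⇒≈) (≈⇒≡[p] ∘ ⇐ ∘ ≡[p]⇒≈)

  δ-respects : ∀ c → Respects≈ (δ c)
  δ-respects c {a} {b} a≈b = δ-cong {c} {a} {c} {b} (≈-trans (≈-sym a≈b)) (≈-trans a≈b)

  res-* : ∀ m n → res p (+ m * + n) ≡ (m ℕ.* n) ℕ.% p
  res-* m n = cong (res p) (sym (ℤ.pos-* m n))

  res≡0⇒∣ : ∀ {a} → res p a ≡ 0 → + p ∣ a
  res≡0⇒∣ eq = ≈0⇒∣ (≡[p]⇒≈ (trans eq (sym (ℕ.m<n⇒m%n≡m (ℕ.>-nonZero⁻¹ p)))))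

  ∣⇒res≡0 : ∀ {a} → + p ∣ a → res p a ≡ 0
  ∣⇒res≡0 p∣a = trans (≈⇒≡[p] (∣⇒≈0 p∣a)) (ℕ.m<n⇒m%n≡m (ℕ.>-nonZero⁻¹ p))

  fromResidue : ℤ → Fin p
  fromResidue a = fromℕ< (n%ℕd<d a p)

  toℕ-fromResidue : ∀ a → toℕ (fromResidue a) ≡ res p a
  toℕ-fromResidue a = Fin.toℕ-fromℕ< (n%ℕd<d a p)

  ≈-fromResidue : ∀ a → + toℕ (fromResidue a) ≈ a
  ≈-fromResidue a = ≈-trans (≈-reflexive (cong +_ (toℕ-fromResidue a))) (≈-sym (≈-residue a))


module PrimeModulus (p : ℕ) .{{_ : NonZero p}} (p-prime : Prime p) where

  open Congruence p public
  open Signed using (_∣_; _∣?_)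

  Unit : ℤ → Set
  Unit a = ¬ (+ p ∣ a)

  1<p : 1 ℕ.< p
  1<p = ℕ.nonTrivial⇒n>1 p {{prime⇒nonTrivial p-prime}}

  euclid : ∀ a b → + p ∣ a * b → (+ p ∣ a) ⊎ (+ p ∣ b)
  euclid a b p∣ab with euclidsLemma ∣ a ∣ ∣ b ∣ p-prime (subst (p ℕ.∣_) (ℤ.abs-* a b) (∣⇒∣ᵤ p∣ab))
  ... | inj₁ p∣a = inj₁ (∣ᵤ⇒∣ p∣a)
  ... | inj₂ p∣b = inj₂ (∣ᵤ⇒∣ p∣b)

  gcd≡1⇒Unit : ∀ {a} → gcd a (+ p) ≡ 1ℤ → Unit a
  gcd≡1⇒Unit {a} gcd≡1 p∣a = ℕ.<⇒≢ 1<p (sym (ℕ.∣1⇒≡1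
    (subst (p ℕ.∣_) (ℤ.+-injective gcd≡1) (ℕ.gcd-greatest (∣⇒∣ᵤ p∣a) (ℕ.∣-refl {p})))))

  Unit-neg : ∀ {a} → Unit a → Unit (- a)
  Unit-neg {a} a-unit p∣-a = a-unit (∣-resp-≡ (ℤ.neg-involutive a) (∣m⇒∣-m p∣-a))

  Unit-divisor : ∀ {a b} → Unit a → + p ∣ a * b → + p ∣ b
  Unit-divisor {a} {b} a-unit p∣ab with euclid a b p∣ab
  ... | inj₁ p∣a = ⊥-elim (a-unit p∣a)
  ... | inj₂ p∣b = p∣b

  Unit-* : ∀ {a b} → Unit a → Unit b → Unit (a * b)
  Unit-* a-unit b-unit = b-unit ∘ Unit-divisor a-unit

  ∣-square⇒∣ : ∀ {a} → + p ∣ a * a → + p ∣ a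
  ∣-square⇒∣ {a} p∣aa with euclid a a p∣aa
  ... | inj₁ p∣a = p∣a
  ... | inj₂ p∣a = p∣a

  Unit-resp-≈ : ∀ {a b} → a ≈ b → Unit a → Unit b
  Unit-resp-≈ a≈b a-unit p∣b = a-unit (∣-resp-≈ (≈-sym a≈b) p∣b)

  Unit-below-p : ∀ {n} → suc n ℕ.< p → Unit (+ suc n)
  Unit-below-p n<p p∣n with () ← trans (sym (ℕ.m<n⇒m%n≡m n<p)) (∣⇒res≡0 p∣n)

  Unit-1 : Unit 1ℤ
  Unit-1 = Unit-below-p 1<p

  Unit-2 : p ≢ 2 → Unit (+ 2)
  Unit-2 p≢2 p∣2 = p≢2 (ℕ.≤-antisym (ℕ.∣⇒≤ (∣⇒∣ᵤ p∣2)) 1<p)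

  Unit⇒≉0 : ∀ {a} → Unit a → ¬ (a ≈ 0ℤ)
  Unit⇒≉0 a-unit a≈0 = a-unit (≈0⇒∣ a≈0)

  Unit-1- : ∀ {y} → ¬ (y ≈ 1ℤ) → Unit (1ℤ - y)
  Unit-1- {y} y≉1 p∣1-y = y≉1 (≈-by (identity y) (∣m⇒∣-m p∣1-y))
    where
    identity : ∀ y → y - 1ℤ ≡ - (1ℤ - y)
    identity = solve-∀

  private
    pos-+* : ∀ a b c → + (a ℕ.+ b ℕ.* c) ≡ + a + + b * + c
    pos-+* a b c = trans (ℤ.pos-+ a (b ℕ.* c)) (cong (_+_ (+ a)) (ℤ.pos-* b c))

  Bézout⇒inverse : ∀ {r} → ℕ.Bézout.Identity 1 p r → ∃ λ α → α * + r ≈ 1ℤ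
  Bézout⇒inverse {r} (ℕ.Bézout.+- x y 1+yr≡xp) =
    - + y , ≈-by (identity (+ y) (+ r)) (∣m⇒∣-m (divides (+ x) 1+yr≡xp′))
    where
    1+yr≡xp′ : 1ℤ + + y * + r ≡ + x * + p
    1+yr≡xp′ = trans (sym (pos-+* 1 y r)) (trans (cong +_ 1+yr≡xp) (ℤ.pos-* x p))
    identity : ∀ y r → - y * r - 1ℤ ≡ - (1ℤ + y * r)
    identity = solve-∀
  Bézout⇒inverse {r} (ℕ.Bézout.-+ x y 1+xp≡yr) =
    + y , ≈-by yr-1≡xp (divides (+ x) refl)
    where
    identity : ∀ x p → 1ℤ + x * p - 1ℤ ≡ x * p
    identity = solve-∀
    yr-1≡xp : + y * + r - 1ℤ ≡ + x * + p
    yr-1≡xp = trans (cong (_- 1ℤ) (trans (sym (ℤ.pos-* y r)) (trans (cong +_ (sym 1+xp≡yr)) (pos-+* 1 x p))))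
                    (identity (+ x) (+ p))

  inverse-exists : ∀ {a} → Unit a → ∃ λ α → α * a ≈ 1ℤ
  inverse-exists {a} a-unit with res p a in r≡ | ≈-residue a
  ... | zero  | _   = ⊥-elim (a-unit (res≡0⇒∣ r≡))
  ... | suc r | a≈r with Bézout⇒inverse (coprime-Bézout (prime⇒coprime p-prime (subst (ℕ._< p) r≡ (n%ℕd<d a p))))
  ...   | α , αr≈1 = α , ≈-trans (*-congˡ α a≈r) αr≈1

  inv : ℤ → ℤ
  inv = invMod p

  private
    res-*ʳ : ∀ m a → res p (+ m * a) ≡ (m ℕ.* res p a) ℕ.% p
    res-*ʳ m a = trans (≈⇒≡[p] (*-congˡ (+ m) (≈-residue a))) (res-* m (res p a))

  inv-inverse : ∀ {a} → Unit a → inv a * a ≈ 1ℤ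
  inv-inverse {a} a-unit with Fin.any? (λ (x : Fin p) → (toℕ x ℕ.* res p a) ℕ.% p ℕ.≟ 1 ℕ.% p)
  ... | yes (x , xa≡1) = ≡[p]⇒≈ (trans (res-*ʳ (toℕ x) a) xa≡1)
  ... | no ∄x with inverse-exists a-unit
  ...   | α , αa≈1 = ⊥-elim (∄x (fromResidue α , trans (sym (res-*ʳ (toℕ (fromResidue α)) a))
          (≈⇒≡[p] (≈-trans (*-cong (≈-fromResidue α) ≈-refl) αa≈1))))

  -- invMod's junk value: 0 when no inverse exists.
  inv-∣ : ∀ {a} → + p ∣ a → inv a ≈ 0ℤ
  inv-∣ {a} p∣a with Fin.any? (λ (x : Fin p) → (toℕ x ℕ.* res p a) ℕ.% p ℕ.≟ 1 ℕ.% p)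
  ... | no _ = ≈-refl
  ... | yes (x , xa≡1) = ⊥-elim (Unit-1 (∣-resp-≈ xa≈1 (∣n⇒∣m*n (+ toℕ x) p∣a)))
    where
    xa≈1 : + toℕ x * a ≈ 1ℤ
    xa≈1 = ≡[p]⇒≈ (trans (res-*ʳ (toℕ x) a) xa≡1)

  inverse-unique : ∀ {u v a} → u * a ≈ 1ℤ → v * a ≈ 1ℤ → u ≈ v
  inverse-unique {u} {v} {a} ua≈1 va≈1 = begin
    u             ≡⟨ ℤ.*-identityʳ u ⟨
    u * 1ℤ        ≈⟨ *-congˡ u (≈-sym va≈1) ⟩
    u * (v * a)   ≡⟨ identity u v a ⟩
    v * (u * a)   ≈⟨ *-congˡ v ua≈1 ⟩
    v * 1ℤ        ≡⟨ ℤ.*-identityʳ v ⟩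
    v             ∎
    where
    open ≈-Reasoning ≈-setoid
    identity : ∀ u v a → u * (v * a) ≡ v * (u * a)
    identity = solve-∀

  Unit-inv : ∀ {a} → Unit a → Unit (inv a)
  Unit-inv {a} a-unit p∣inv = Unit-1 (∣-resp-≈ (inv-inverse a-unit) (∣m⇒∣m*n a p∣inv))

  inv-cong : ∀ {a b} → a ≈ b → inv a ≈ inv b
  inv-cong {a} {b} a≈b with + p ∣? a
  ... | yes p∣a = ≈-trans (inv-∣ p∣a) (≈-sym (inv-∣ (∣-resp-≈ a≈b p∣a)))
  ... | no a-unit = inverse-unique (≈-trans (*-congˡ (inv a) (≈-sym a≈b)) (inv-inverse a-unit))
                                   (inv-inverse (Unit-resp-≈ a≈b a-unit))

  inv-involutive : ∀ a → inv (inv a) ≈ a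
  inv-involutive a with + p ∣? a
  ... | yes p∣a = ≈-trans (inv-∣ (≈0⇒∣ (inv-∣ p∣a))) (≈-sym (∣⇒≈0 p∣a))
  ... | no a-unit = inverse-unique (inv-inverse (Unit-inv a-unit))
                                   (≈-trans (≈-reflexive (ℤ.*-comm a (inv a))) (inv-inverse a-unit))

  inv-1 : inv 1ℤ ≈ 1ℤ
  inv-1 = ≈-trans (≈-reflexive (sym (ℤ.*-identityʳ (inv 1ℤ)))) (inv-inverse Unit-1)

  χ : ℤ → ℤ
  χ = legendre p

  IsSquare : ℤ → Set
  IsSquare a = ∃ λ s → s * s ≈ a

  IsSquareMod⇒IsSquare : ∀ {a} → IsSquareMod p a → IsSquare a
  IsSquareMod⇒IsSquare (x , xx≡a) = + toℕ x , ≡[p]⇒≈ (trans (res-* (toℕ x) (toℕ x)) xx≡a)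

  IsSquare⇒IsSquareMod : ∀ {a} → IsSquare a → IsSquareMod p a
  IsSquare⇒IsSquareMod (s , ss≈a) = fromResidue s ,
    trans (sym (res-* (toℕ (fromResidue s)) (toℕ (fromResidue s))))
          (≈⇒≡[p] (≈-trans (*-cong (≈-fromResidue s) (≈-fromResidue s)) ss≈a))

  IsSquare-resp-≈ : ∀ {a b} → a ≈ b → IsSquare a → IsSquare b
  IsSquare-resp-≈ a≈b (s , ss≈a) = s , ≈-trans ss≈a a≈b

  χ-∣ : ∀ {a} → + p ∣ a → χ a ≡ 0ℤ
  χ-∣ {a} p∣a with res p a ℕ.≟ 0
  ... | yes _ = refl
  ... | no r≢0 = ⊥-elim (r≢0 (∣⇒res≡0 p∣a))

  χ-square : ∀ {a} → Unit a → IsSquare a → χ a ≡ 1ℤ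
  χ-square {a} a-unit a-square with res p a ℕ.≟ 0
  ... | yes r≡0 = ⊥-elim (a-unit (res≡0⇒∣ r≡0))
  ... | no _ with isSquareMod? p a
  ...   | yes _ = refl
  ...   | no ¬square = ⊥-elim (¬square (IsSquare⇒IsSquareMod a-square))

  χ-nonsquare : ∀ {a} → Unit a → ¬ IsSquare a → χ a ≡ -1ℤ
  χ-nonsquare {a} a-unit a-nonsquare with res p a ℕ.≟ 0
  ... | yes r≡0 = ⊥-elim (a-unit (res≡0⇒∣ r≡0))
  ... | no _ with isSquareMod? p a
  ...   | yes square = ⊥-elim (a-nonsquare (IsSquareMod⇒IsSquare square))
  ...   | no _ = refl

  isSquare? : ∀ a → Dec (IsSquare a)
  isSquare? a = map′ IsSquareMod⇒IsSquare IsSquare⇒IsSquareMod (isSquareMod? p a)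

  χ-cong : ∀ {a b} → a ≈ b → χ a ≡ χ b
  χ-cong {a} {b} a≈b with + p ∣? a | isSquare? a
  ... | yes p∣a | _ = trans (χ-∣ p∣a) (sym (χ-∣ (∣-resp-≈ a≈b p∣a)))
  ... | no a-unit | yes a-square =
        trans (χ-square a-unit a-square) (sym (χ-square (Unit-resp-≈ a≈b a-unit) (IsSquare-resp-≈ a≈b a-square)))
  ... | no a-unit | no a-nonsquare =
        trans (χ-nonsquare a-unit a-nonsquare)
              (sym (χ-nonsquare (Unit-resp-≈ a≈b a-unit) (a-nonsquare ∘ IsSquare-resp-≈ (≈-sym a≈b))))

  χ-*-square : ∀ {s} a → Unit s → χ (s * s * a) ≡ χ a
  χ-*-square {s} a s-unit with + p ∣? a | isSquare? a
  ... | yes p∣a | _ = trans (χ-∣ (∣n⇒∣m*n (s * s) p∣a)) (sym (χ-∣ p∣a))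
  ... | no a-unit | yes (r , rr≈a) =
        trans (χ-square ssa-unit (s * r , ≈-trans (≈-reflexive (identity s r)) (*-congˡ (s * s) rr≈a)))
              (sym (χ-square a-unit (r , rr≈a)))
    where
    ssa-unit : Unit (s * s * a)
    ssa-unit = Unit-* (Unit-* s-unit s-unit) a-unit
    identity : ∀ s r → s * r * (s * r) ≡ s * s * (r * r)
    identity = solve-∀
  ... | no a-unit | no a-nonsquare =
        trans (χ-nonsquare (Unit-* (Unit-* s-unit s-unit) a-unit) ssa-nonsquare) (sym (χ-nonsquare a-unit a-nonsquare))
    where
    identity : ∀ i r s a → i * r * (i * r) - a ≡ i * i * (r * r - s * s * a) + (i * s - 1ℤ) * (i * s + 1ℤ) * a
    identity = solve-∀
    ssa-nonsquare : ¬ IsSquare (s * s * a)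
    ssa-nonsquare (r , rr≈ssa) = a-nonsquare (inv s * r , ≈-by (identity (inv s) r s a)
      (∣m∣n⇒∣m+n (∣n⇒∣m*n (inv s * inv s) (∣-difference rr≈ssa))
                 (∣m⇒∣m*n a (∣m⇒∣m*n (inv s * s + 1ℤ) (∣-difference (inv-inverse s-unit))))))


module ResidueSums (p : ℕ) .{{_ : NonZero p}} (p-prime : Prime p) where

  open PrimeModulus p p-prime public
  open Signed using (_∣_; _∣?_)

  Σres : (ℤ → ℤ) → ℤ
  Σres f = ∑[ i < p ] f (+ toℕ i)

  Σres-cong : ∀ {f g} → (∀ z → f z ≡ g z) → Σres f ≡ Σres g
  Σres-cong f≗g = sum-cong-≗ {p} (f≗g ∘ +_ ∘ toℕ)

  Σres≡f0+Σu : ∀ f → Σres f ≡ f 0ℤ + Σu p f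
  Σres≡f0+Σu = sum-residues p

  Σu-cong : ∀ {f g} → (∀ z → Unit z → f z ≡ g z) → Σu p f ≡ Σu p g
  Σu-cong {f} {g} f≗g = trans (Σu≡sum p f) (trans (sum-cong-≗ {p ℕ.∸ 1} (λ i → f≗g _ (index-Unit i))) (sym (Σu≡sum p g)))
    where
    index-Unit : (i : Fin (p ℕ.∸ 1)) → Unit (+ suc (toℕ i))
    index-Unit i = Unit-below-p (ℕ.≤-trans (ℕ.s≤s (Fin.toℕ<n i)) (ℕ.≤-reflexive (ℕ.suc-pred p)))

  Σres-bijection : ∀ (σ τ : ℤ → ℤ) → (∀ {a b} → a ≈ b → σ a ≈ σ b) → (∀ {a b} → a ≈ b → τ a ≈ τ b) →
                   (∀ z → σ (τ z) ≈ z) → (∀ z → τ (σ z) ≈ z) →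
                   ∀ {f} → Respects≈ f → Σres (f ∘ σ) ≡ Σres f
  Σres-bijection σ τ σ-cong τ-cong στ≈id τσ≈id {f} f-cong = sym (begin
    ∑[ i < p ] f (+ toℕ i)                              ≡⟨ ∑-permute {p} {p} _ π ⟩
    ∑[ i < p ] f (+ toℕ (fromResidue (σ (+ toℕ i))))    ≡⟨ sum-cong-≗ {p} (λ i → f-cong (≈-fromResidue (σ (+ toℕ i)))) ⟩
    ∑[ i < p ] f (σ (+ toℕ i))                          ∎)
    where
    open ≡-Reasoning
    fromResidue-cong : ∀ {a b} → a ≈ b → fromResidue a ≡ fromResidue b
    fromResidue-cong {a} {b} a≈b =
      Fin.toℕ-injective (trans (toℕ-fromResidue a) (trans (≈⇒≡[p] a≈b) (sym (toℕ-fromResidue b))))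
    fromResidue-toℕ : ∀ i → fromResidue (+ toℕ i) ≡ i
    fromResidue-toℕ i = Fin.toℕ-injective (trans (toℕ-fromResidue (+ toℕ i)) (ℕ.m<n⇒m%n≡m (Fin.toℕ<n i)))
    lift : (ℤ → ℤ) → Fin p → Fin p
    lift φ i = fromResidue (φ (+ toℕ i))
    lift-inverse : ∀ {φ ψ} → (∀ {a b} → a ≈ b → φ a ≈ φ b) → (∀ z → φ (ψ z) ≈ z) → ∀ i → lift φ (lift ψ i) ≡ i
    lift-inverse {φ} {ψ} φ-cong φψ≈id i =
      trans (fromResidue-cong (≈-trans (φ-cong (≈-fromResidue (ψ (+ toℕ i)))) (φψ≈id (+ toℕ i)))) (fromResidue-toℕ i)
    π : Permutation p p
    π = permutation (lift σ) (lift τ) (lift-inverse σ-cong στ≈id) (lift-inverse τ-cong τσ≈id)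

  Σres-affine : ∀ {k} c → Unit k → ∀ {f} → Respects≈ f → Σres (λ z → f (k * z + c)) ≡ Σres f
  Σres-affine {k} c k-unit = Σres-bijection (λ z → k * z + c) (λ z → inv k * (z - c))
    (λ a≈b → +-congʳ c (*-congˡ k a≈b)) (λ a≈b → *-congˡ (inv k) (+-congʳ (- c) a≈b))
    (λ z → ≈-by (identity₁ k (inv k) z c) (∣m⇒∣m*n (z - c) ik-1))
    (λ z → ≈-by (identity₂ k (inv k) z c) (∣m⇒∣m*n z ik-1))
    where
    ik-1 : + p ∣ inv k * k - 1ℤ
    ik-1 = ∣-difference (inv-inverse k-unit)
    identity₁ : ∀ k i z c → k * (i * (z - c)) + c - z ≡ (i * k - 1ℤ) * (z - c)
    identity₁ = solve-∀
    identity₂ : ∀ k i z c → i * (k * z + c - c) - z ≡ (i * k - 1ℤ) * z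
    identity₂ = solve-∀

  Σres-inv : ∀ {f} → Respects≈ f → Σres (f ∘ inv) ≡ Σres f
  Σres-inv = Σres-bijection inv inv inv-cong inv-cong inv-involutive inv-involutive

  Σres-δ : ∀ c → Σres (δ c) ≡ 1ℤ
  Σres-δ c = begin
    Σres (δ c)                       ≡⟨ Σres-affine c Unit-1 {δ c} (δ-respects c) ⟨
    Σres (λ z → δ c (1ℤ * z + c))    ≡⟨ Σres-cong {λ z → δ c (1ℤ * z + c)} {δ 0ℤ} (λ z → δ-cong (shift⇒ z) (shift⇐ z)) ⟩
    Σres (δ 0ℤ)                      ≡⟨ Σres≡f0+Σu (δ 0ℤ) ⟩
    δ 0ℤ 0ℤ + Σu p (δ 0ℤ)            ≡⟨ cong₂ _+_ (δ-≈ (≈-refl {0ℤ})) (Σu-cong {δ 0ℤ} {λ _ → 0ℤ} (λ z z-unit → δ-≉ (Unit⇒≉0 z-unit))) ⟩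
    1ℤ + Σu p (λ _ → 0ℤ)             ≡⟨ cong (_+_ 1ℤ) (Σu-0 p) ⟩
    1ℤ                               ∎
    where
    open ≡-Reasoning
    identity : ∀ z c → 1ℤ * z + c - c ≡ z - 0ℤ
    identity = solve-∀
    shift⇒ : ∀ z → 1ℤ * z + c ≈ c → z ≈ 0ℤ
    shift⇒ z (mk≈ d) = ≈-by (sym (identity z c)) d
    shift⇐ : ∀ z → z ≈ 0ℤ → 1ℤ * z + c ≈ c
    shift⇐ z (mk≈ d) = ≈-by (identity z c) d

  Σu-δ : ∀ {c} → Unit c → Σu p (δ c) ≡ 1ℤ
  Σu-δ {c} c-unit = begin
    Σu p (δ c)              ≡⟨ ℤ.+-identityˡ (Σu p (δ c)) ⟨
    0ℤ + Σu p (δ c)         ≡⟨ cong (_+ Σu p (δ c)) (δ-≉ {c} {0ℤ} (c-unit ∘ ≈0⇒∣ ∘ ≈-sym)) ⟨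
    δ c 0ℤ + Σu p (δ c)     ≡⟨ Σres≡f0+Σu (δ c) ⟨
    Σres (δ c)              ≡⟨ Σres-δ c ⟩
    1ℤ                      ∎
    where open ≡-Reasoning

  Σu-δ≉ : ∀ {c} → Unit c → ∀ f → Respects≈ f → Σu p (λ z → δ≉ c z * f z) ≡ Σres f - f 0ℤ - f c
  Σu-δ≉ {c} c-unit f f-cong = identity (Σres f) (f 0ℤ) (Σu p g) (f c) (begin
    Σres f                                      ≡⟨ Σres-cong {f} {λ z → g z + δ c z * f z} (λ z → 𝟙-¬?-split (z ≡[ p ]? c) (f z)) ⟩
    Σres (λ z → g z + δ c z * f z)              ≡⟨ ∑-distrib-+ {p} _ _ ⟩
    Σres g + Σres (λ z → δ c z * f z)           ≡⟨ cong₂ _+_ (Σres≡f0+Σu g) (Σres-cong {λ z → δ c z * f z} {λ z → f c * δ c z} δf≡fδ) ⟩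
    (g 0ℤ + Σu p g) + Σres (λ z → f c * δ c z)  ≡⟨ cong₂ _+_ (cong (_+ Σu p g) g0≡f0) (sym (*-distribˡ-sum {p} (f c) _)) ⟩
    (f 0ℤ + Σu p g) + f c * Σres (δ c)          ≡⟨ cong (λ t → (f 0ℤ + Σu p g) + f c * t) (Σres-δ c) ⟩
    (f 0ℤ + Σu p g) + f c * 1ℤ                  ≡⟨ cong (_+_ (f 0ℤ + Σu p g)) (ℤ.*-identityʳ (f c)) ⟩
    (f 0ℤ + Σu p g) + f c                       ∎)
    where
    open ≡-Reasoning
    g : ℤ → ℤ
    g z = δ≉ c z * f z
    g0≡f0 : g 0ℤ ≡ f 0ℤ
    g0≡f0 = trans (cong (_* f 0ℤ) (𝟙-yes (¬? (0ℤ ≡[ p ]? c)) (c-unit ∘ ≈0⇒∣ ∘ ≈-sym ∘ ≡[p]⇒≈))) (ℤ.*-identityˡ (f 0ℤ))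
    δf≡fδ : ∀ z → δ c z * f z ≡ f c * δ c z
    δf≡fδ z = trans (𝟙-*-cong (z ≡[ p ]? c) (f-cong ∘ ≡[p]⇒≈)) (ℤ.*-comm (δ c z) (f c))
    identity : ∀ S F₀ U F → S ≡ (F₀ + U) + F → U ≡ S - F₀ - F
    identity S F₀ U F refl = lemma F₀ U F
      where
      lemma : ∀ F₀ U F → U ≡ (F₀ + U) + F - F₀ - F
      lemma = solve-∀

  -- The roots ±r of s² = w are distinct because p is odd.
  δ-square : p ≢ 2 → ∀ {w r} → Unit w → r * r ≈ w → ∀ s → δ w (s * s) ≡ δ r s + δ (- r) s
  δ-square p≢2 {w} {r} w-unit rr≈w s with s ≡[ p ]? r | s ≡[ p ]? (- r)
  ... | yes s≡r | yes s≡-r = ⊥-elim (r≉-r (≈-trans (≈-sym (≡[p]⇒≈ {s} {r} s≡r)) (≡[p]⇒≈ s≡-r)))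
    where
    identity : ∀ r → r - - r ≡ + 2 * r
    identity = solve-∀
    r≉-r : ¬ (r ≈ - r)
    r≉-r (mk≈ d) with euclid (+ 2) r (∣-resp-≡ (identity r) d)
    ... | inj₁ p∣2 = Unit-2 p≢2 p∣2
    ... | inj₂ p∣r = w-unit (∣-resp-≈ rr≈w (∣n⇒∣m*n r p∣r))
  ... | yes s≡r | no _ = δ-≈ (≈-trans (*-cong s≈r s≈r) rr≈w)
    where
    s≈r : s ≈ r
    s≈r = ≡[p]⇒≈ s≡r
  ... | no _ | yes s≡-r = δ-≈ (≈-trans (*-cong s≈-r s≈-r) (≈-trans (≈-reflexive (identity r)) rr≈w))
    where
    identity : ∀ r → - r * - r ≡ r * r
    identity = solve-∀
    s≈-r : s ≈ - r
    s≈-r = ≡[p]⇒≈ s≡-r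
  ... | no s≢r | no s≢-r = δ-≉ ss≉w
    where
    identity : ∀ s r w → (s * s - w) + - (r * r - w) ≡ (s - r) * (s + r)
    identity = solve-∀
    s+r≡s--r : ∀ s r → s + r ≡ s - - r
    s+r≡s--r = solve-∀
    ss≉w : ¬ (s * s ≈ w)
    ss≉w (mk≈ d) with euclid (s - r) (s + r) (∣-resp-≡ (identity s r w) (∣m∣n⇒∣m+n d (∣m⇒∣-m (∣-difference rr≈w))))
    ... | inj₁ p∣s-r = s≢r (≈⇒≡[p] {s} {r} (mk≈ p∣s-r))
    ... | inj₂ p∣s+r = s≢-r (≈⇒≡[p] {s} { - r} (mk≈ (∣-resp-≡ (s+r≡s--r s r) p∣s+r)))

  Σres-0 : Σres (λ _ → 0ℤ) ≡ 0ℤ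
  Σres-0 = sum-replicate-zero p

  Σres-square-roots : p ≢ 2 → ∀ w → Σres (λ s → δ w (s * s)) ≡ 1ℤ + χ w
  Σres-square-roots p≢2 w with + p ∣? w | isSquare? w
  ... | yes p∣w | _ = begin
    Σres (λ s → δ w (s * s))   ≡⟨ Σres-cong {λ s → δ w (s * s)} {δ 0ℤ} (λ s → δ-cong (ss≈w⇒s≈0 s) (s≈0⇒ss≈w s)) ⟩
    Σres (δ 0ℤ)                ≡⟨ Σres-δ 0ℤ ⟩
    1ℤ + 0ℤ                    ≡⟨ cong (_+_ 1ℤ) (χ-∣ p∣w) ⟨
    1ℤ + χ w                   ∎
    where
    open ≡-Reasoning
    ss≈w⇒s≈0 : ∀ s → s * s ≈ w → s ≈ 0ℤ
    ss≈w⇒s≈0 s ss≈w = ∣⇒≈0 (∣-square⇒∣ (∣-resp-≈ (≈-sym ss≈w) p∣w))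
    s≈0⇒ss≈w : ∀ s → s ≈ 0ℤ → s * s ≈ w
    s≈0⇒ss≈w s s≈0 = ≈-trans (*-cong s≈0 s≈0) (≈-sym (∣⇒≈0 p∣w))
  ... | no w-unit | yes (r , rr≈w) = begin
    Σres (λ s → δ w (s * s))           ≡⟨ Σres-cong {λ s → δ w (s * s)} {λ s → δ r s + δ (- r) s} (δ-square p≢2 {w} {r} w-unit rr≈w) ⟩
    Σres (λ s → δ r s + δ (- r) s)     ≡⟨ ∑-distrib-+ {p} _ _ ⟩
    Σres (δ r) + Σres (δ (- r))        ≡⟨ cong₂ _+_ (Σres-δ r) (Σres-δ (- r)) ⟩
    1ℤ + 1ℤ                            ≡⟨ cong (_+_ 1ℤ) (χ-square w-unit (r , rr≈w)) ⟨
    1ℤ + χ w                           ∎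
    where open ≡-Reasoning
  ... | no w-unit | no w-nonsquare = begin
    Σres (λ s → δ w (s * s))   ≡⟨ Σres-cong {λ s → δ w (s * s)} {λ _ → 0ℤ} (λ s → δ-≉ (w-nonsquare ∘ (s ,_))) ⟩
    Σres (λ _ → 0ℤ)            ≡⟨ Σres-0 ⟩
    1ℤ + -1ℤ                   ≡⟨ cong (_+_ 1ℤ) (χ-nonsquare w-unit w-nonsquare) ⟨
    1ℤ + χ w                   ∎
    where open ≡-Reasoning

  -- Counting the pairs (s, w) with s² = w in two ways.
  Σres-χ : p ≢ 2 → Σres χ ≡ 0ℤ
  Σres-χ p≢2 = ∙-cancelˡ (Σres (λ _ → 1ℤ)) (Σres χ) 0ℤ (begin
    Σres (λ _ → 1ℤ) + Σres χ                    ≡⟨ ∑-distrib-+ {p} _ _ ⟨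
    Σres (λ w → 1ℤ + χ w)                       ≡⟨ Σres-cong {λ w → 1ℤ + χ w} {λ w → Σres (λ s → δ w (s * s))} (sym ∘ Σres-square-roots p≢2) ⟩
    Σres (λ w → Σres (λ s → δ w (s * s)))       ≡⟨ ∑-comm {p} {p} _ ⟩
    Σres (λ s → Σres (λ w → δ w (s * s)))       ≡⟨ Σres-cong {λ s → Σres (λ w → δ w (s * s))} {λ _ → 1ℤ} (λ s → Σres-δ-dual (s * s)) ⟩
    Σres (λ _ → 1ℤ)                             ≡⟨ ℤ.+-identityʳ _ ⟨
    Σres (λ _ → 1ℤ) + 0ℤ                        ∎)
    where
    open ≡-Reasoning
    Σres-δ-dual : ∀ c → Σres (λ w → δ w c) ≡ 1ℤ
    Σres-δ-dual c = trans (Σres-cong {λ w → δ w c} {δ c} (λ w → δ-cong {w} {c} {c} {w} ≈-sym ≈-sym)) (Σres-δ c)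

  Σres-χ-affine : p ≢ 2 → ∀ {k} c → Unit k → Σres (λ z → χ (k * z + c)) ≡ 0ℤ
  Σres-χ-affine p≢2 c k-unit = trans (Σres-affine c k-unit {χ} χ-cong) (Σres-χ p≢2)

  Σres-χ-inv-affine : p ≢ 2 → ∀ {k} c → Unit k → Σres (λ z → χ (k * inv z + c)) ≡ 0ℤ
  Σres-χ-inv-affine p≢2 {k} c k-unit =
    trans (Σres-inv {λ z → χ (k * z + c)} (χ-cong ∘ +-congʳ c ∘ *-congˡ k)) (Σres-χ-affine p≢2 c k-unit)


module QuadraticCharacterSums (p : ℕ) .{{_ : NonZero p}} (p-prime : Prime p) (p≢2 : p ≢ 2)
                              (A B C : ℤ) (A-unit : ¬ (+ p Signed.∣ A))
                              (p∣disc : + p Signed.∣ B * B - + 4 * A * C) where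

  open ResidueSums p p-prime
  open Signed using (_∣_; _∣?_)

  q : ℤ → ℤ
  q b = A * (b * b) + B * b + C

  b₀ : ℤ
  b₀ = - B * inv (+ 2 * A)

  private
    2A-inverse : + p ∣ inv (+ 2 * A) * (+ 2 * A) - 1ℤ
    2A-inverse = ∣-difference (inv-inverse (Unit-* (Unit-2 p≢2) A-unit))

    4A-unit : Unit (+ 4 * A)
    4A-unit = subst Unit (4≡2*2 A) (Unit-* (Unit-* (Unit-2 p≢2) (Unit-2 p≢2)) A-unit)
      where
      4≡2*2 : ∀ A → + 2 * + 2 * A ≡ + 4 * A
      4≡2*2 = solve-∀

    completing-the-square : ∀ A B C b → + 4 * A * (A * (b * b) + B * b + C) + (B * B - + 4 * A * C) ≡ (+ 2 * A * b + B) * (+ 2 * A * b + B)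
    completing-the-square = solve-∀

  root⇒p∣2Ab+B : ∀ {b} → q b ≈ 0ℤ → + p ∣ + 2 * A * b + B
  root⇒p∣2Ab+B {b} qb≈0 =
    ∣-square⇒∣ (∣-resp-≡ (completing-the-square A B C b) (∣m∣n⇒∣m+n (∣n⇒∣m*n (+ 4 * A) (≈0⇒∣ qb≈0)) p∣disc))

  p∣2Ab+B⇒root : ∀ {b} → + p ∣ + 2 * A * b + B → q b ≈ 0ℤ
  p∣2Ab+B⇒root {b} p∣2Ab+B = ∣⇒≈0 (Unit-divisor 4A-unit
    (∣m+n∣n⇒∣m (∣-resp-≡ (sym (completing-the-square A B C b)) (∣m⇒∣m*n (+ 2 * A * b + B) p∣2Ab+B)) p∣disc))

  p∣2Ab+B⇒≈b₀ : ∀ {b} → + p ∣ + 2 * A * b + B → b ≈ b₀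
  p∣2Ab+B⇒≈b₀ {b} p∣2Ab+B = ≈-by (identity A B b (inv (+ 2 * A)))
      (∣m∣n⇒∣m+n (∣n⇒∣m*n (inv (+ 2 * A)) p∣2Ab+B) (∣n⇒∣m*n (- b) 2A-inverse))
    where
    identity : ∀ A B b i → b - - B * i ≡ i * (+ 2 * A * b + B) + - b * (i * (+ 2 * A) - 1ℤ)
    identity = solve-∀

  ≈b₀⇒p∣2Ab+B : ∀ {b} → b ≈ b₀ → + p ∣ + 2 * A * b + B
  ≈b₀⇒p∣2Ab+B {b} b≈b₀ = ∣-resp-≡ (sym (identity A B b (inv (+ 2 * A))))
      (∣m∣n⇒∣m+n (∣n⇒∣m*n (+ 2 * A) (∣-difference b≈b₀)) (∣n⇒∣m*n (- B) 2A-inverse))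
    where
    identity : ∀ A B b i → + 2 * A * b + B ≡ + 2 * A * (b - - B * i) + - B * (i * (+ 2 * A) - 1ℤ)
    identity = solve-∀

  root⇒≈b₀ : ∀ {b} → q b ≈ 0ℤ → b ≈ b₀
  root⇒≈b₀ = p∣2Ab+B⇒≈b₀ ∘ root⇒p∣2Ab+B

  ≈b₀⇒root : ∀ {b} → b ≈ b₀ → q b ≈ 0ℤ
  ≈b₀⇒root = p∣2Ab+B⇒root ∘ ≈b₀⇒p∣2Ab+B

  root⇒Ab²≈C : ∀ {b} → q b ≈ 0ℤ → A * (b * b) ≈ C
  root⇒Ab²≈C {b} qb≈0 =
    ≈-by (identity A B C b) (∣m∣n⇒∣m+n (∣m⇒∣-m (≈0⇒∣ qb≈0)) (∣n⇒∣m*n b (root⇒p∣2Ab+B qb≈0)))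
    where
    identity : ∀ A B C b → A * (b * b) - C ≡ - (A * (b * b) + B * b + C) + b * (+ 2 * A * b + B)
    identity = solve-∀

  T₁ T₂ : ℤ → ℤ → ℤ → ℤ
  T₁ b x y = y * (1ℤ - x) * (A * inv (1ℤ - y) * (y - x) * (b * b) - B * b - C * inv x)
  T₂ b x y = y * (A * inv (1ℤ - y) * (b * b) - C * inv x)

  -- The summands of S₁ and S₂ are local to their definitions; these name them.
  S₁-as-sum : ∃ λ (F : ℤ → ℤ → ℤ → ℤ) → S₁ p A B C ≡ Σu p λ b → Σu p λ x → Σu p λ y → F b x y
  S₁-as-sum = _ , refl

  S₂-as-sum : ∃ λ (F : ℤ → ℤ → ℤ → ℤ) → S₂ p A B C ≡ Σu p λ b → Σu p λ x → Σu p λ y → F b x y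
  S₂-as-sum = _ , refl

  S₁-summand≡ : ∀ b x y → proj₁ S₁-as-sum b x y ≡ δ≉ 1ℤ x * δ≉ 1ℤ y * δ b₀ b * χ (T₁ b x y)
  S₁-summand≡ b x y with x ≡[ p ]? 1ℤ | y ≡[ p ]? 1ℤ | b ≡[ p ]? b₀
  ... | no _  | no _  | yes _ = sym (ℤ.*-identityˡ _)
  ... | yes _ | _     | _     = refl
  ... | no _  | yes _ | _     = refl
  ... | no _  | no _  | no _  = refl

  S₂-summand-q : ∀ b x y → proj₁ S₂-as-sum b x y ≡ δ≉ 1ℤ x * δ≉ 1ℤ y * δ 0ℤ (q b) * χ (T₂ b x y)
  S₂-summand-q b x y with x ≡[ p ]? 1ℤ | y ≡[ p ]? 1ℤ | q b ≡[ p ]? 0ℤ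
  ... | no _  | no _  | yes _ = sym (ℤ.*-identityˡ _)
  ... | yes _ | _     | _     = refl
  ... | no _  | yes _ | _     = refl
  ... | no _  | no _  | no _  = refl

  S₂-summand≡ : ∀ b x y → proj₁ S₂-as-sum b x y ≡ δ≉ 1ℤ x * δ≉ 1ℤ y * δ b₀ b * χ (T₂ b x y)
  S₂-summand≡ b x y = trans (S₂-summand-q b x y)
    (cong (λ t → δ≉ 1ℤ x * δ≉ 1ℤ y * t * χ (T₂ b x y)) (δ-cong root⇒≈b₀ ≈b₀⇒root))

  support-cong : ∀ {b x y u v} → (¬ (x ≈ 1ℤ) → ¬ (y ≈ 1ℤ) → b ≈ b₀ → u ≡ v) →
            δ≉ 1ℤ x * δ≉ 1ℤ y * δ b₀ b * u ≡ δ≉ 1ℤ x * δ≉ 1ℤ y * δ b₀ b * v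
  support-cong {b} {x} {y} u≡v with x ≡[ p ]? 1ℤ | y ≡[ p ]? 1ℤ | b ≡[ p ]? b₀
  ... | no x≢1 | no y≢1 | yes b≡b₀ = cong (1ℤ *_) (u≡v (x≢1 ∘ ≈⇒≡[p]) (y≢1 ∘ ≈⇒≡[p]) (≡[p]⇒≈ b≡b₀))
  ... | yes _  | _      | _        = refl
  ... | no _   | yes _  | _        = refl
  ... | no _   | no _   | no _     = refl

  χT₁≡χT₂ : ∀ {b x y} → Unit x → ¬ (x ≈ 1ℤ) → ¬ (y ≈ 1ℤ) → b ≈ b₀ → χ (T₁ b x y) ≡ χ (T₂ b x y)
  χT₁≡χT₂ {b} {x} {y} x-unit x≉1 y≉1 b≈b₀ = trans (χ-cong T₁≈[1-x]²T₂) (χ-*-square (T₂ b x y) (Unit-1- x≉1))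
    where
    identity : ∀ A B C b x y u v →
      y * (1ℤ - x) * (A * v * (y - x) * (b * b) - B * b - C * u) - (1ℤ - x) * (1ℤ - x) * (y * (A * v * (b * b) - C * u))
      ≡ y * (1ℤ - x) * (- (A * (b * b) + B * b + C) + A * (b * b) * - (v * (1ℤ - y) - 1ℤ) + C * - (u * x - 1ℤ))
    identity = solve-∀
    T₁≈[1-x]²T₂ : T₁ b x y ≈ (1ℤ - x) * (1ℤ - x) * T₂ b x y
    T₁≈[1-x]²T₂ = ≈-by (identity A B C b x y (inv x) (inv (1ℤ - y))) (∣n⇒∣m*n (y * (1ℤ - x))
      (∣m∣n⇒∣m+n (∣m∣n⇒∣m+n (∣m⇒∣-m (≈0⇒∣ (≈b₀⇒root b≈b₀)))
                            (∣n⇒∣m*n (A * (b * b)) (∣m⇒∣-m (∣-difference (inv-inverse (Unit-1- y≉1))))))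
                 (∣n⇒∣m*n C (∣m⇒∣-m (∣-difference (inv-inverse x-unit))))))

  S₁≡S₂ : S₁ p A B C ≡ S₂ p A B C
  S₁≡S₂ = trans (proj₂ S₁-as-sum) (trans
    (Σu-cong λ b _ → Σu-cong λ x x-unit → Σu-cong λ y _ → begin
      proj₁ S₁-as-sum b x y                                  ≡⟨ S₁-summand≡ b x y ⟩
      δ≉ 1ℤ x * δ≉ 1ℤ y * δ b₀ b * χ (T₁ b x y)              ≡⟨ support-cong {b} {x} {y} (χT₁≡χT₂ x-unit) ⟩
      δ≉ 1ℤ x * δ≉ 1ℤ y * δ b₀ b * χ (T₂ b x y)              ≡⟨ S₂-summand≡ b x y ⟨
      proj₁ S₂-as-sum b x y                                  ∎)
    (sym (proj₂ S₂-as-sum)))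
    where open ≡-Reasoning

  S₂≡0 : + p ∣ C → S₂ p A B C ≡ 0ℤ
  S₂≡0 p∣C = trans (proj₂ S₂-as-sum)
    (trans (Σu-cong λ b b-unit → trans (Σu-cong λ x _ → trans (Σu-cong λ y _ → summand≡0 b-unit x y) (Σu-0 p)) (Σu-0 p))
           (Σu-0 p))
    where
    no-root : ∀ {b} → Unit b → ¬ (q b ≈ 0ℤ)
    no-root b-unit qb≈0 = b-unit (∣-square⇒∣ (Unit-divisor A-unit (∣-resp-≈ (≈-sym (root⇒Ab²≈C qb≈0)) p∣C)))
    summand≡0 : ∀ {b} → Unit b → ∀ x y → proj₁ S₂-as-sum b x y ≡ 0ℤ
    summand≡0 {b} b-unit x y = trans (S₂-summand-q b x y)
      (trans (cong (λ t → δ≉ 1ℤ x * δ≉ 1ℤ y * t * χ (T₂ b x y)) (δ-≉ (no-root b-unit)))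
             (cong (_* χ (T₂ b x y)) (ℤ.*-zeroʳ (δ≉ 1ℤ x * δ≉ 1ℤ y))))

  module _ (C-unit : Unit C) where

    X : ℤ → ℤ → ℤ
    X x y = χ (y * (C * inv (1ℤ - y) - C * inv x))

    K : ℤ → ℤ → ℤ
    K x y = δ≉ 1ℤ x * (δ≉ 1ℤ y * X x y)

    b₀-unit : Unit b₀
    b₀-unit p∣b₀ = C-unit (∣-resp-≈ (root⇒Ab²≈C (≈b₀⇒root ≈-refl)) (∣n⇒∣m*n A (∣n⇒∣m*n b₀ p∣b₀)))

    summand≡δK : ∀ b x y → proj₁ S₂-as-sum b x y ≡ δ b₀ b * K x y
    summand≡δK b x y = trans (S₂-summand≡ b x y)
      (trans (support-cong {b} {x} {y} (λ _ _ b≈b₀ → χ-cong (T₂≈ b≈b₀))) (rearrange (δ≉ 1ℤ x) (δ≉ 1ℤ y) (δ b₀ b) (X x y)))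
      where
      identity : ∀ A C b y u v → y * (A * v * (b * b) - C * u) - y * (C * v - C * u) ≡ y * v * (A * (b * b) - C)
      identity = solve-∀
      T₂≈ : b ≈ b₀ → T₂ b x y ≈ y * (C * inv (1ℤ - y) - C * inv x)
      T₂≈ b≈b₀ = ≈-by (identity A C b y (inv x) (inv (1ℤ - y)))
        (∣n⇒∣m*n (y * inv (1ℤ - y)) (∣-difference (root⇒Ab²≈C (≈b₀⇒root b≈b₀))))
      rearrange : ∀ a b c d → a * b * c * d ≡ c * (a * (b * d))
      rearrange = solve-∀

    S₂≡ΣK : S₂ p A B C ≡ Σu p λ x → Σu p λ y → K x y
    S₂≡ΣK = begin
      S₂ p A B C                                             ≡⟨ proj₂ S₂-as-sum ⟩
      Σu p (λ b → Σu p λ x → Σu p λ y → proj₁ S₂-as-sum b x y) ≡⟨ Σu-cong (λ b _ → Σu-cong λ x _ → Σu-cong λ y _ → summand≡δK b x y) ⟩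
      Σu p (λ b → Σu p λ x → Σu p λ y → δ b₀ b * K x y)       ≡⟨ Σu-cong (λ b _ → trans (Σu-cong λ x _ → sym (*-distribˡ-Σu p (δ b₀ b) (K x)))
                                                                                        (sym (*-distribˡ-Σu p (δ b₀ b) ΣK))) ⟩
      Σu p (λ b → δ b₀ b * Σu p ΣK)                           ≡⟨ Σu-cong (λ b _ → ℤ.*-comm (δ b₀ b) (Σu p ΣK)) ⟩
      Σu p (λ b → Σu p ΣK * δ b₀ b)                           ≡⟨ *-distribˡ-Σu p (Σu p ΣK) (δ b₀) ⟨
      Σu p ΣK * Σu p (δ b₀)                                   ≡⟨ cong (Σu p ΣK *_) (Σu-δ b₀-unit) ⟩
      Σu p ΣK * 1ℤ                                            ≡⟨ ℤ.*-identityʳ (Σu p ΣK) ⟩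
      Σu p ΣK                                                 ∎
      where
      open ≡-Reasoning
      ΣK : ℤ → ℤ
      ΣK x = Σu p (K x)

    Σres-X : ∀ {y} → Unit y → Σres (λ x → X x y) ≡ 0ℤ
    Σres-X {y} y-unit = trans (Σres-cong {λ x → X x y} {λ x → χ (- (y * C) * inv x + y * (C * v))} (λ x → cong χ (identity y C v (inv x))))
                              (Σres-χ-inv-affine p≢2 (y * (C * v)) (Unit-neg (Unit-* y-unit C-unit)))
      where
      v : ℤ
      v = inv (1ℤ - y)
      identity : ∀ y C v u → y * (C * v - C * u) ≡ - (y * C) * u + y * (C * v)
      identity = solve-∀

    Σu-δ≉X : ∀ {y} → Unit y → Σu p (λ x → δ≉ 1ℤ x * X x y) ≡ - (X 0ℤ y + X 1ℤ y)
    Σu-δ≉X {y} y-unit = trans (Σu-δ≉ Unit-1 (λ x → X x y) X-respects)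
      (trans (cong (λ t → t - X 0ℤ y - X 1ℤ y) (Σres-X y-unit)) (identity (X 0ℤ y) (X 1ℤ y)))
      where
      X-respects : Respects≈ (λ x → X x y)
      X-respects = χ-cong ∘ *-congˡ y ∘ +-cong (≈-refl {C * inv (1ℤ - y)}) ∘ -‿cong ∘ *-congˡ C ∘ inv-cong
      identity : ∀ a b → 0ℤ - a - b ≡ - (a + b)
      identity = solve-∀

    G₀ G₁ G : ℤ → ℤ
    G₀ y = χ (C * inv y + - C)
    G₁ y = χ (C * inv (1ℤ - y))
    G y = G₀ y + G₁ y

    X0≡G₀ : ∀ {y} → Unit y → ¬ (y ≈ 1ℤ) → X 0ℤ y ≡ G₀ y
    X0≡G₀ {y} y-unit y≉1 =
      trans (χ-cong {y * (C * v - C * inv 0ℤ)} {y * v * (y * v) * (C * inv y + - C)}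
                    (≈-sym (≈-by (identity y C (inv y) v (inv 0ℤ)) p∣difference)))
            (χ-*-square (C * inv y + - C) (Unit-* y-unit (Unit-inv 1-y-unit)))
      where
      v : ℤ
      v = inv (1ℤ - y)
      1-y-unit : Unit (1ℤ - y)
      1-y-unit = Unit-1- y≉1
      identity : ∀ y C u v i → y * v * (y * v) * (C * u + - C) - y * (C * v - C * i)
                             ≡ y * C * v * (v * (u * y - 1ℤ) + (v * (1ℤ - y) - 1ℤ)) + y * C * i
      identity = solve-∀
      p∣difference : + p ∣ y * C * v * (v * (inv y * y - 1ℤ) + (v * (1ℤ - y) - 1ℤ)) + y * C * inv 0ℤ
      p∣difference = ∣m∣n⇒∣m+n
        (∣n⇒∣m*n (y * C * v) (∣m∣n⇒∣m+n (∣n⇒∣m*n v (∣-difference (inv-inverse y-unit)))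
                                        (∣-difference (inv-inverse 1-y-unit))))
        (∣n⇒∣m*n (y * C) (≈0⇒∣ (inv-∣ p∣0)))

    X1≡G₁ : ∀ {y} → Unit y → ¬ (y ≈ 1ℤ) → X 1ℤ y ≡ G₁ y
    X1≡G₁ {y} y-unit y≉1 =
      trans (χ-cong {y * (C * v - C * inv 1ℤ)} {y * y * (C * v)} (≈-sym (≈-by (identity y C v (inv 1ℤ)) p∣difference)))
            (χ-*-square (C * v) y-unit)
      where
      v : ℤ
      v = inv (1ℤ - y)
      identity : ∀ y C v i → y * y * (C * v) - y * (C * v - C * i) ≡ y * C * (- (v * (1ℤ - y) - 1ℤ) + (i - 1ℤ))
      identity = solve-∀
      p∣difference : + p ∣ y * C * (- (v * (1ℤ - y) - 1ℤ) + (inv 1ℤ - 1ℤ))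
      p∣difference = ∣n⇒∣m*n (y * C) (∣m∣n⇒∣m+n (∣m⇒∣-m (∣-difference (inv-inverse (Unit-1- y≉1)))) (∣-difference inv-1))

    Σres-G₁ : Σres G₁ ≡ 0ℤ
    Σres-G₁ = begin
      Σres G₁                          ≡⟨ Σres-cong {G₁} {λ y → f (-1ℤ * y + 1ℤ)} (λ y → cong χ (identity C y)) ⟩
      Σres (λ y → f (-1ℤ * y + 1ℤ))    ≡⟨ Σres-affine 1ℤ (Unit-neg Unit-1) f-respects ⟩
      Σres f                           ≡⟨ Σres-χ-inv-affine p≢2 0ℤ C-unit ⟩
      0ℤ                               ∎
      where
      open ≡-Reasoning
      f : ℤ → ℤ
      f z = χ (C * inv z + 0ℤ)
      f-respects : Respects≈ f
      f-respects = χ-cong ∘ +-congʳ 0ℤ ∘ *-congˡ C ∘ inv-cong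
      identity : ∀ C y → C * inv (1ℤ - y) ≡ C * inv (-1ℤ * y + 1ℤ) + 0ℤ
      identity C y = trans (sym (ℤ.+-identityʳ _)) (cong (λ t → C * inv t + 0ℤ) (1-y≡-1*y+1 y))
        where
        1-y≡-1*y+1 : ∀ y → 1ℤ - y ≡ -1ℤ * y + 1ℤ
        1-y≡-1*y+1 = solve-∀

    Σres-G : Σres G ≡ 0ℤ
    Σres-G = trans (∑-distrib-+ {p} _ _) (cong₂ _+_ (Σres-χ-inv-affine p≢2 (- C) C-unit) Σres-G₁)

    G[0] : G 0ℤ ≡ χ (- C) + χ C
    G[0] = cong₂ _+_ (χ-cong (≈-trans (+-congʳ (- C) (*-congˡ C (inv-∣ p∣0))) (≈-reflexive (identity C))))
                     (χ-cong (≈-trans (*-congˡ C inv-1) (≈-reflexive (ℤ.*-identityʳ C))))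
      where
      identity : ∀ C → C * 0ℤ + - C ≡ - C
      identity = solve-∀

    G[1] : G 1ℤ ≡ 0ℤ
    G[1] = cong₂ _+_ (χ-∣ (≈0⇒∣ (≈-trans (+-congʳ (- C) (≈-trans (*-congˡ C inv-1) (≈-reflexive (ℤ.*-identityʳ C))))
                                         (≈-reflexive (ℤ.+-inverseʳ C)))))
                     (χ-∣ (∣n⇒∣m*n C (≈0⇒∣ (inv-∣ p∣0))))

    ΣK≡χC+χ-C : (Σu p λ x → Σu p λ y → K x y) ≡ χ C + χ (- C)
    ΣK≡χC+χ-C = begin
      (Σu p λ x → Σu p λ y → K x y)                              ≡⟨ Σu-comm p K ⟩
      (Σu p λ y → Σu p λ x → δ≉ 1ℤ x * (δ≉ 1ℤ y * X x y))        ≡⟨ Σu-cong (λ y _ → trans (Σu-cong λ x _ → swap (δ≉ 1ℤ x) (δ≉ 1ℤ y) (X x y))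
                                                                                             (sym (*-distribˡ-Σu p (δ≉ 1ℤ y) (λ x → δ≉ 1ℤ x * X x y)))) ⟩
      (Σu p λ y → δ≉ 1ℤ y * Σu p (λ x → δ≉ 1ℤ x * X x y))        ≡⟨ Σu-cong (λ y y-unit → cong (δ≉ 1ℤ y *_) (Σu-δ≉X y-unit)) ⟩
      (Σu p λ y → δ≉ 1ℤ y * - (X 0ℤ y + X 1ℤ y))                  ≡⟨ Σu-cong (λ y y-unit → 𝟙-*-cong (¬? (y ≡[ p ]? 1ℤ))
                                                                       (λ y≢1 → cong -_ (cong₂ _+_ (X0≡G₀ y-unit (y≢1 ∘ ≈⇒≡[p])) (X1≡G₁ y-unit (y≢1 ∘ ≈⇒≡[p]))))) ⟩
      (Σu p λ y → δ≉ 1ℤ y * - G y)                                ≡⟨ Σu-cong (λ y _ → ℤ.neg-distribʳ-* (δ≉ 1ℤ y) (G y)) ⟨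
      (Σu p λ y → - (δ≉ 1ℤ y * G y))                              ≡⟨ -‿distrib-Σu p (λ y → δ≉ 1ℤ y * G y) ⟨
      - (Σu p λ y → δ≉ 1ℤ y * G y)                                ≡⟨ cong -_ (Σu-δ≉ Unit-1 G G-respects) ⟩
      - (Σres G - G 0ℤ - G 1ℤ)                                    ≡⟨ cong -_ (cong₂ _-_ (cong₂ _-_ Σres-G G[0]) G[1]) ⟩
      - (0ℤ - (χ (- C) + χ C) - 0ℤ)                               ≡⟨ identity (χ (- C)) (χ C) ⟩
      χ C + χ (- C)                                               ∎
      where
      open ≡-Reasoning
      swap : ∀ a b c → a * (b * c) ≡ b * (a * c)
      swap = solve-∀
      identity : ∀ a b → - (0ℤ - (a + b) - 0ℤ) ≡ b + a
      identity = solve-∀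
      G-respects : Respects≈ G
      G-respects a≈b = cong₂ _+_ (χ-cong (+-congʳ (- C) (*-congˡ C (inv-cong a≈b))))
                                 (χ-cong (*-congˡ C (inv-cong (+-cong (≈-refl {1ℤ}) (-‿cong a≈b)))))

  S₂≡χC+χ-C : S₂ p A B C ≡ χ C + χ (- C)
  S₂≡χC+χ-C with + p ∣? C
  ... | no C-unit = trans (S₂≡ΣK C-unit) (ΣK≡χC+χ-C C-unit)
  ... | yes p∣C = trans (S₂≡0 p∣C) (sym (cong₂ _+_ (χ-∣ p∣C) (χ-∣ (∣m⇒∣-m p∣C))))


open import Data.Integer.Divisibility using (_∣_)

lemma5p5 : (p : ℕ) .{{_ : NonZero p}} → Prime p → p ≢ 2 →
    (A B C : ℤ) → gcd A (+ p) ≡ 1ℤ → (+ p) ∣ (B * B - + 4 * A * C) →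
    (S₁ p A B C ≡ S₂ p A B C) × (S₂ p A B C ≡ legendre p C + legendre p (- C))
lemma5p5 p p-prime p≢2 A B C gcd≡1 p∣disc = S₁≡S₂ , S₂≡χC+χ-C
  where
  open QuadraticCharacterSums p p-prime p≢2 A B C (PrimeModulus.gcd≡1⇒Unit p p-prime gcd≡1) (∣ᵤ⇒∣ p∣disc)
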